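{- Let $D$ be a minimal counterexample to the conjecture described in the context, and $C$ its Hamilton cycle as described there. For all vertices $x,y$ of $D$ with $y\neq x^-$ (and $y\ne x$), $x$ monochromatically dominates $y$ in the subtournament $D[xCy]$.
   Context: A 3-coloured tournament is a finite tournament each of whose edges is coloured red, blue or green. A triple of vertices spans a $T_3$ if the three edges between them form a directed cycle with three distinct colours. For distinct vertices $x,y$, $x$ monochromatically dominates $y$ if there is a directed path from $x$ to $y$ all of whose edges have the same colour; domination in a subtournament means the path lies in it. The conjecture: every 3-coloured tournament has a triple spanning a $T_3$ or a vertex monochromatically dominating every other vertex. A minimal counterexample is a 3-coloured tournament $D$ with no $T_3$ and no vertex dominating all others, such that every proper nonempty subtournament has a $T_3$ or a vertex monochromatically dominating all its other vertices within it. Such $D$ has a unique directed Hamilton cycle $C$ such that each vertex monochromatically dominates every vertex except its predecessor on $C$; $x^-$ denotes the predecessor of $x$ on $C$, $xCy$ denotes the subpath of $C$ from $x$ to $y$, and $D[U]$ the subtournament spanned by a vertex set $U$. -}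

module Defs where

open import Data.Nat using (ℕ; zero; suc; _+_; _∸_; _≤_; _≤ᵇ_)
open import Data.Vec using (tabulate)
open import Data.Nat.DivMod using (_%_)
open import Data.Fin using (Fin; toℕ)
open import Data.Fin.Permutation using (Permutation′; _⟨$⟩ˡ_)
open import Data.Fin.Subset using (Subset; _∈_; _∉_; ⊤)
open import Data.Product using (Σ; ∃; _×_; _,_)
open import Data.Sum using (_⊎_)
open import Relation.Nullary using (¬_)
open import Relation.Binary.PropositionalEquality using (_≡_; _≢_)

data Colour : Set where
  red blue green : Colour

-- A 3-coloured tournament on the vertex set Fin n.
-- Arc x y : the edge between x and y is directed from x to y.
-- colour x y : the colour of that edge (only meaningful when Arc x y).
record Tournament3 (n : ℕ) : Set₁ where
  field
    Arc       : Fin n → Fin n → Set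
    colour    : Fin n → Fin n → Colour
    irrefl    : ∀ x → ¬ Arc x x
    total     : ∀ x y → x ≢ y → Arc x y ⊎ Arc y x
    antisym   : ∀ x y → Arc x y → ¬ Arc y x

module _ {n : ℕ} (D : Tournament3 n) where
  open Tournament3 D

  -- A monochromatic directed walk of colour c from x to y (at least one edge),
  -- all of whose vertices lie in U.  (A walk contains a path with the same ends.)
  data MonoPath (U : Subset n) (c : Colour) : Fin n → Fin n → Set where
    edge : ∀ {x y} → x ∈ U → y ∈ U → Arc x y → colour x y ≡ c → MonoPath U c x y
    step : ∀ {x z y} → x ∈ U → z ∈ U → Arc x z → colour x z ≡ c →
           MonoPath U c z y → MonoPath U c x y

  MonoDom : Subset n → Fin n → Fin n → Set
  MonoDom U x y = ∃ λ c → MonoPath U c x y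

  T3 : Subset n → Fin n → Fin n → Fin n → Set
  T3 U x y z = x ∈ U × y ∈ U × z ∈ U × Arc x y × Arc y z × Arc z x
             × colour x y ≢ colour y z × colour y z ≢ colour z x × colour z x ≢ colour x y

  HasT3 : Subset n → Set
  HasT3 U = Σ (Fin n) λ x → Σ (Fin n) λ y → Σ (Fin n) λ z → T3 U x y z

  HasDominator : Subset n → Set
  HasDominator U = Σ (Fin n) λ x → x ∈ U × (∀ y → y ∈ U → y ≢ x → MonoDom U x y)

  -- D[U] satisfies the conjecture
  Good : Subset n → Set
  Good U = HasT3 U ⊎ HasDominator U

  ProperNonempty : Subset n → Set
  ProperNonempty U = (∃ λ x → x ∈ U) × (∃ λ x → x ∉ U)

  MinimalCounterexample : Set
  MinimalCounterexample = ¬ Good ⊤ × (∀ U → ProperNonempty U → Good U)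

-- Hamilton cycles on a vertex set Fin (suc m), encoded by a permutation π:
-- position (π ⟨$⟩ˡ x) of vertex x on the cycle; C visits vertices in increasing
-- position, wrapping around.  steps π x y = number of steps along C from x to y.
module _ {m : ℕ} (π : Permutation′ (suc m)) where
  steps : Fin (suc m) → Fin (suc m) → ℕ
  steps x y = (toℕ (π ⟨$⟩ˡ y) + suc m ∸ toℕ (π ⟨$⟩ˡ x)) % suc m

  IsPred : Fin (suc m) → Fin (suc m) → Set
  IsPred p x = steps p x ≡ 1

  Segment : Fin (suc m) → Fin (suc m) → Subset (suc m)
  Segment x y = tabulate (λ z → steps x z ≤ᵇ steps x y)

  record IsDominatingHamCycle (D : Tournament3 (suc m)) : Set where
    open Tournament3 D
    field
      cycleArcs : ∀ x y → steps x y ≡ 1 → Arc x y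
      dominates : ∀ x y → y ≢ x → ¬ IsPred y x → MonoDom D ⊤ x y

module Submission where

-- Let S = xCy be the segment of the Hamilton cycle C
-- from x to y.  If S is all of D, the dominating cycle already gives a
-- monochromatic x–y path.  Otherwise D[S] is a proper nonempty subtournament,
-- so by minimality it contains a T3 or a vertex v dominating it.  A T3 of D[S]
-- is a T3 of D, which is impossible.  If v = x we are done.  If v ≠ x, then the
-- predecessor v⁻ of v also lies on S, so v reaches v⁻ inside D[S] and reaches
-- every other vertex by the cycle property: v dominates D, again impossible.

open import Defs
open import Data.Nat using (ℕ; suc; NonZero; _+_; _∸_; _≤_; _<_; _≤ᵇ_; z≤n)
open import Data.Nat.Properties
open import Data.Nat.DivMod using (_%_; %-distribˡ-+; m%n%n≡m%n; [m+n]%n≡m%n; m<n⇒m%n≡m; m%n<n; n%n≡0)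
open import Data.Nat.Tactic.RingSolver using (solve-∀)
open import Data.Fin using (Fin; toℕ) renaming (_≟_ to _≟ᶠ_)
open import Data.Fin.Properties using (toℕ<n; toℕ-injective; all?; ¬∀⟶∃¬)
open import Data.Fin.Permutation using (Permutation′; _⟨$⟩ˡ_; _⟨$⟩ʳ_; inverseʳ)
open import Data.Fin.Subset using (Subset; _∈_; _⊆_; ⊤)
open import Data.Fin.Subset.Properties using (∈⊤; _∈?_)
open import Data.Vec.Properties using (lookup∘tabulate; lookup⇒[]=; []=⇒lookup)
open import Data.Bool.Properties using (T-≡)
open import Function.Bundles using (Equivalence)
open import Data.Product using (_,_)
open import Data.Sum using (inj₁; inj₂)
open import Data.Empty using (⊥-elim)
open import Relation.Nullary using (¬_; yes; no)
open import Relation.Binary.PropositionalEquality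

%-absorbʳ : ∀ a k d .{{_ : NonZero d}} → (a + k % d) % d ≡ (a + k) % d
%-absorbʳ a k d = begin
  (a + k % d) % d           ≡⟨ %-distribˡ-+ a (k % d) d ⟩
  (a % d + k % d % d) % d   ≡⟨ cong (λ t → (a % d + t) % d) (m%n%n≡m%n k d) ⟩
  (a % d + k % d) % d       ≡⟨ %-distribˡ-+ a k d ⟨
  (a + k) % d               ∎
  where open ≡-Reasoning

module Cycle {m : ℕ} (π : Permutation′ (suc m)) where
  open ≡-Reasoning

  private
    N : ℕ
    N = suc m

  pos : Fin N → ℕ
  pos z = toℕ (π ⟨$⟩ˡ z)

  pos<N : ∀ z → pos z < N
  pos<N z = toℕ<n (π ⟨$⟩ˡ z)

  pos-injective : ∀ {x y} → pos x ≡ pos y → x ≡ y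
  pos-injective {x} {y} eq = begin
    x                   ≡⟨ inverseʳ π ⟨
    π ⟨$⟩ʳ (π ⟨$⟩ˡ x)   ≡⟨ cong (π ⟨$⟩ʳ_) (toℕ-injective eq) ⟩
    π ⟨$⟩ʳ (π ⟨$⟩ˡ y)   ≡⟨ inverseʳ π ⟩
    y                   ∎

  steps-lands : ∀ x y → (pos x + steps π x y) % N ≡ pos y
  steps-lands x y = begin
    (pos x + (pos y + N ∸ pos x) % N) % N   ≡⟨ %-absorbʳ (pos x) _ N ⟩
    (pos x + (pos y + N ∸ pos x)) % N       ≡⟨ cong (_% N) (m+[n∸m]≡n px≤py+N) ⟩
    (pos y + N) % N                         ≡⟨ [m+n]%n≡m%n (pos y) N ⟩
    pos y % N                               ≡⟨ m<n⇒m%n≡m (pos<N y) ⟩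
    pos y                                   ∎
    where
    px≤py+N : pos x ≤ pos y + N
    px≤py+N = ≤-trans (<⇒≤ (pos<N x)) (m≤n+m N (pos y))

  steps-self : ∀ x → steps π x x ≡ 0
  steps-self x = trans (cong (_% N) (m+n∸m≡n (pos x) N)) (n%n≡0 N)

  steps-zero⇒≡ : ∀ {x y} → steps π x y ≡ 0 → x ≡ y
  steps-zero⇒≡ {x} {y} st = pos-injective (begin
    pos x                          ≡⟨ m<n⇒m%n≡m (pos<N x) ⟨
    pos x % N                      ≡⟨ cong (_% N) (+-identityʳ (pos x)) ⟨
    (pos x + 0) % N                ≡⟨ cong (λ t → (pos x + t) % N) st ⟨
    (pos x + steps π x y) % N      ≡⟨ steps-lands x y ⟩
    pos y                          ∎)

  steps-additive : ∀ x w v → (steps π x w + steps π w v) % N ≡ steps π x v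
  steps-additive x w v = begin
    (steps π x w + steps π w v) % N          ≡⟨ %-distribˡ-+ (pos w + N ∸ pos x) (pos v + N ∸ pos w) N ⟨
    ((pos w + N ∸ pos x) + (pos v + N ∸ pos w)) % N
      ≡⟨ cong₂ (λ s t → (s + t) % N) (+-∸-assoc (pos w) (within x)) (+-∸-assoc (pos v) (within w)) ⟩
    ((pos w + (N ∸ pos x)) + (pos v + (N ∸ pos w))) % N
      ≡⟨ cong (_% N) (interchange (pos w) (N ∸ pos x) (pos v) (N ∸ pos w)) ⟩
    ((pos v + (N ∸ pos x)) + (pos w + (N ∸ pos w))) % N
      ≡⟨ cong₂ (λ s t → (s + t) % N) (+-∸-assoc (pos v) (within x)) (sym (m+[n∸m]≡n (within w))) ⟨
    ((pos v + N ∸ pos x) + N) % N            ≡⟨ [m+n]%n≡m%n (pos v + N ∸ pos x) N ⟩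
    steps π x v                              ∎
    where
    within : ∀ z → pos z ≤ N
    within z = <⇒≤ (pos<N z)
    interchange : ∀ b p c q → (b + p) + (c + q) ≡ (c + p) + (b + q)
    interchange = solve-∀

  steps-succ : ∀ x {w v} → IsPred π w v → suc (steps π x w) % N ≡ steps π x v
  steps-succ x {w} {v} w⁻v = begin
    suc (steps π x w) % N            ≡⟨ cong (_% N) (+-comm 1 (steps π x w)) ⟩
    (steps π x w + 1) % N            ≡⟨ cong (λ t → (steps π x w + t) % N) w⁻v ⟨
    (steps π x w + steps π w v) % N  ≡⟨ steps-additive x w v ⟩
    steps π x v                      ∎

  -- Unless the step from w to v returns to x, no wrap-around happens.
  steps-pred : ∀ {x w v} → IsPred π w v → v ≢ x → suc (steps π x w) ≡ steps π x v
  steps-pred {x} {w} {v} w⁻v v≢x with suc (steps π x w) ≟ N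
  ... | yes full = ⊥-elim (v≢x (sym (steps-zero⇒≡ (begin
    steps π x v                      ≡⟨ steps-succ x w⁻v ⟨
    suc (steps π x w) % N            ≡⟨ cong (_% N) full ⟩
    N % N                            ≡⟨ n%n≡0 N ⟩
    0                                ∎))))
  ... | no notFull = trans (sym (m<n⇒m%n≡m noWrap)) (steps-succ x w⁻v)
    where
    noWrap : suc (steps π x w) < N
    noWrap = ≤∧≢⇒< (m%n<n (pos w + N ∸ pos x) N) notFull

  ∈-Segment : ∀ {x y z} → steps π x z ≤ steps π x y → z ∈ Segment π x y
  ∈-Segment {x} {y} {z} le = lookup⇒[]= z (Segment π x y)
    (trans (lookup∘tabulate (λ u → steps π x u ≤ᵇ steps π x y) z)
           (Equivalence.to T-≡ (≤⇒≤ᵇ le)))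

  Segment-∈ : ∀ {x y z} → z ∈ Segment π x y → steps π x z ≤ steps π x y
  Segment-∈ {x} {y} {z} z∈S = ≤ᵇ⇒≤ _ _ (Equivalence.from T-≡
    (trans (sym (lookup∘tabulate (λ u → steps π x u ≤ᵇ steps π x y) z)) ([]=⇒lookup z∈S)))

  start-∈-Segment : ∀ x y → x ∈ Segment π x y
  start-∈-Segment x y = ∈-Segment (subst (_≤ steps π x y) (sym (steps-self x)) z≤n)

  end-∈-Segment : ∀ x y → y ∈ Segment π x y
  end-∈-Segment x y = ∈-Segment ≤-refl

  pred-∈-Segment : ∀ {x y v w} → v ∈ Segment π x y → v ≢ x → IsPred π w v → w ∈ Segment π x y
  pred-∈-Segment {x} {y} {v} {w} v∈S v≢x w⁻v = ∈-Segment
    (≤-trans (n≤1+n (steps π x w)) (≤-trans (≤-reflexive (steps-pred w⁻v v≢x)) (Segment-∈ v∈S)))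

module Widening {n : ℕ} (D : Tournament3 n) {U V : Subset n} (U⊆V : U ⊆ V) where

  monoPath-widen : ∀ {c x y} → MonoPath D U c x y → MonoPath D V c x y
  monoPath-widen (edge x∈U y∈U arc col) = edge (U⊆V x∈U) (U⊆V y∈U) arc col
  monoPath-widen (step x∈U z∈U arc col p) = step (U⊆V x∈U) (U⊆V z∈U) arc col (monoPath-widen p)

  monoDom-widen : ∀ {x y} → MonoDom D U x y → MonoDom D V x y
  monoDom-widen (c , p) = c , monoPath-widen p

  hasT3-widen : HasT3 D U → HasT3 D V
  hasT3-widen (a , b , c , a∈U , b∈U , c∈U , rest) = a , b , c , U⊆V a∈U , U⊆V b∈U , U⊆V c∈U , rest

-- On a dominating Hamilton cycle, a vertex that dominates a subtournament
-- containing its predecessor dominates the whole tournament: the predecessor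
-- is reached inside the subtournament, every other vertex by the cycle property.
dominator-lifts : ∀ {m} {D : Tournament3 (suc m)} {π : Permutation′ (suc m)} {U v} →
                  IsDominatingHamCycle π D → (∀ {w} → IsPred π w v → w ∈ U) →
                  (∀ w → w ∈ U → w ≢ v → MonoDom D U v w) → HasDominator D ⊤
dominator-lifts {D = D} {π} {v = v} hc predInU domU = v , ∈⊤ , dominatesAll
  where
  dominatesAll : ∀ w → w ∈ ⊤ → w ≢ v → MonoDom D ⊤ v w
  dominatesAll w _ w≢v with steps π w v ≟ 1
  ... | yes w⁻v = Widening.monoDom-widen D (λ _ → ∈⊤) (domU w (predInU w⁻v) w≢v)
  ... | no ¬w⁻v = IsDominatingHamCycle.dominates hc v w w≢v ¬w⁻v

open Cycle using (start-∈-Segment; end-∈-Segment; pred-∈-Segment)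

lemma2p6 : ∀ {m : ℕ} (D : Tournament3 (suc m)) (π : Permutation′ (suc m)) →
           MinimalCounterexample D → IsDominatingHamCycle π D →
           ∀ (x y : Fin (suc m)) → y ≢ x → ¬ IsPred π y x →
           MonoDom D (Segment π x y) x y
lemma2p6 {m} D π (notGood , minimal) hc x y y≢x ¬y⁻x
  with all? (_∈? Segment π x y)
... | yes whole = Widening.monoDom-widen D (λ {z} _ → whole z)
                    (IsDominatingHamCycle.dominates hc x y y≢x ¬y⁻x)
... | no proper with minimal (Segment π x y) ((x , start-∈-Segment π x y) ,
                                             ¬∀⟶∃¬ (suc m) _ (_∈? Segment π x y) proper)
...   | inj₁ t3 = ⊥-elim (notGood (inj₁ (Widening.hasT3-widen D (λ _ → ∈⊤) t3)))
...   | inj₂ (v , v∈S , vDom) with v ≟ᶠ x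
...     | yes refl = vDom y (end-∈-Segment π v y) y≢x
...     | no v≢x = ⊥-elim (notGood (inj₂ (dominator-lifts hc (pred-∈-Segment π v∈S v≢x) vDom)))
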